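{- For $k\ge 0$ let $A_k=\begin{pmatrix} x & q^k(x^2+s)\\ 1 & q^kx\end{pmatrix}$. Then for every $n\ge 1$, $$\begin{pmatrix} T_n(x,s,q) & (x^2+s)U_{n-1}(x,qs,q)\\ U_{n-1}(x,s,q) & T_n\!\left(x,\frac{s}{q},q\right)\end{pmatrix}=A_{n-1}A_{n-2}\cdots A_0.$$
   Context: Let $q$ be a real number with $q\neq -1$ and $q\neq 0$. $T_0(x,s,q)=1$, $T_1(x,s,q)=x$, $T_n(x,s,q)=(1+q^{n-1})xT_{n-1}(x,s,q)+q^{n-1}sT_{n-2}(x,s,q)$ for $n\ge2$; $U_{ -1}(x,s,q)=0$, $U_0(x,s,q)=1$, $U_n(x,s,q)=(1+q^{n})xU_{n-1}(x,s,q)+q^{n-1}sU_{n-2}(x,s,q)$ for $n\ge 1$. Here $T_n(x,s/q,q)$ is $T_n(x,s,q)$ with $s$ replaced by $s/q$. -}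

module Defs where

open import Level using (Level)
open import Data.Nat using (ℕ; zero; suc)
open import Data.Product using (_×_; _,_)
open import Algebra.Bundles using (CommutativeRing)

module _ {c ℓ : Level} (R : CommutativeRing c ℓ) where
  open CommutativeRing R

  pow : Carrier → ℕ → Carrier
  pow q zero = 1#
  pow q (suc n) = q * pow q n

  Tcheb : Carrier → Carrier → Carrier → ℕ → Carrier
  Tcheb x s q zero = 1#
  Tcheb x s q (suc zero) = x
  Tcheb x s q (suc (suc n)) =
    (1# + pow q (suc n)) * x * Tcheb x s q (suc n)
    + pow q (suc n) * s * Tcheb x s q n

  -- U_n(x,s,q) for n ≥ 0 (U_{-1} = 0, U_0 = 1,
  -- U_n = (1+q^n) x U_{n-1} + q^{n-1} s U_{n-2}   (n ≥ 1))
  -- Ucheb n computes U_n; U_1 = (1+q) x since U_{-1} = 0.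
  Ucheb : Carrier → Carrier → Carrier → ℕ → Carrier
  Ucheb x s q zero = 1#
  Ucheb x s q (suc zero) = (1# + q) * x
  Ucheb x s q (suc (suc n)) =
    (1# + pow q (suc (suc n))) * x * Ucheb x s q (suc n)
    + pow q (suc n) * s * Ucheb x s q n

  -- 2×2 matrices as (a , b , c , d) = ((a b) (c d))
  Mat2 : Set c
  Mat2 = Carrier × Carrier × Carrier × Carrier

  _·ₘ_ : Mat2 → Mat2 → Mat2
  (a , b , c′ , d) ·ₘ (e , f , g , h) =
    (a * e + b * g , a * f + b * h , c′ * e + d * g , c′ * f + d * h)

  I₂ : Mat2
  I₂ = (1# , 0# , 0# , 1#)

  _≈ₘ_ : Mat2 → Mat2 → Set ℓ
  (a , b , c′ , d) ≈ₘ (e , f , g , h) = (a ≈ e) × (b ≈ f) × (c′ ≈ g) × (d ≈ h)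

  Amat : Carrier → Carrier → Carrier → ℕ → Mat2
  Amat x s q k = (x , pow q k * (x * x + s) , 1# , pow q k * x)

  Aprod : Carrier → Carrier → Carrier → ℕ → Mat2
  Aprod x s q zero = I₂
  Aprod x s q (suc n) = Amat x s q n ·ₘ Aprod x s q n

-- Writing A_k = A(q^k), the product A(qp) A(p) equals (1 + qp) x A(p) + diag(qp s, p s)
-- (a Cayley–Hamilton-type identity, checked entrywise).  Multiplying on the right by
-- A_{m-1} ⋯ A_0 shows that the entries of the products P_m = A_{m-1} ⋯ A_0 satisfy the
-- three-term recurrence of T_n in the first row and of U_n in the second.  The four
-- claimed entries satisfy the same recurrences and agree with P_1 and P_2, so they agree
-- with P_m for every m.

module Submission where

open import Defs
open import Level using (Level)
open import Data.Nat using (ℕ; zero; suc)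
open import Data.Product using (_,_; _×_; proj₁; proj₂)
open import Relation.Nullary using (¬_)
open import Algebra.Bundles using (CommutativeSemiring; CommutativeRing)
import Algebra.Solver.Ring.NaturalCoefficients.Default as RingSolver

module LinearRecurrence {c ℓ : Level} (S : CommutativeSemiring c ℓ) where
  open CommutativeSemiring S
  open RingSolver S using (solve; _:=_; _:+_; _:*_)

  Recurrence : (α β f : ℕ → Carrier) → Set ℓ
  Recurrence α β f = ∀ n → f (suc (suc n)) ≈ α n * f (suc n) + β n * f n

  recurrence-unique : ∀ {α β f g} → Recurrence α β f → Recurrence α β g →
                      f 0 ≈ g 0 → f 1 ≈ g 1 → ∀ n → f n ≈ g n
  recurrence-unique {α} {β} {f} {g} rec-f rec-g f₀≈g₀ f₁≈g₁ n = proj₁ (agree n)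
    where
    agree : ∀ n → f n ≈ g n × f (suc n) ≈ g (suc n)
    agree zero = f₀≈g₀ , f₁≈g₁
    agree (suc n) with agree n
    ... | fₙ≈gₙ , fₙ₊₁≈gₙ₊₁ =
      fₙ₊₁≈gₙ₊₁ , trans (rec-f n) (trans (+-cong (*-congˡ fₙ₊₁≈gₙ₊₁) (*-congˡ fₙ≈gₙ)) (sym (rec-g n)))

  Recurrence-congʳ : ∀ {α β β′ f} → (∀ n → β n ≈ β′ n) → Recurrence α β f → Recurrence α β′ f
  Recurrence-congʳ β≈β′ rec n = trans (rec n) (+-congˡ (*-congʳ (β≈β′ n)))

  Recurrence-scaleˡ : ∀ {α β f} (k : Carrier) → Recurrence α β f → Recurrence α β (λ n → k * f n)
  Recurrence-scaleˡ {α} {β} {f} k rec n = trans (*-congˡ (rec n)) (distribute (α n) (β n) (f (suc n)) (f n))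
    where
    distribute : ∀ a b u v → k * (a * u + b * v) ≈ a * (k * u) + b * (k * v)
    distribute = solve 5 (λ k a b u v → k :* (a :* u :+ b :* v) := a :* (k :* u) :+ b :* (k :* v)) refl k

module ChebyshevProducts {c ℓ : Level} (R : CommutativeRing c ℓ) (x s q : CommutativeRing.Carrier R) where
  open CommutativeRing R
  open RingSolver commutativeSemiring using (solve; _:=_; _:+_; _:*_; con)
  open LinearRecurrence commutativeSemiring

  infixl 7 _⊙_
  infix 4 _≋_

  _⊙_ : Mat2 R → Mat2 R → Mat2 R
  _⊙_ = _·ₘ_ R

  _≋_ : Mat2 R → Mat2 R → Set ℓ
  _≋_ = _≈ₘ_ R

  A : ℕ → Mat2 R
  A = Amat R x s q

  P : ℕ → Mat2 R
  P = Aprod R x s q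

  entry₁₁ entry₁₂ entry₂₁ entry₂₂ : Mat2 R → Carrier
  entry₁₁ (a , _ , _ , _) = a
  entry₁₂ (_ , b , _ , _) = b
  entry₂₁ (_ , _ , c′ , _) = c′
  entry₂₂ (_ , _ , _ , d) = d

  Amat-two-step : ∀ m (M : Mat2 R) →
    let α = (1# + pow R q (suc m)) * x
        M′ = A m ⊙ M
    in A (suc m) ⊙ M′ ≋
       ( α * entry₁₁ M′ + pow R q (suc m) * s * entry₁₁ M
       , α * entry₁₂ M′ + pow R q (suc m) * s * entry₁₂ M
       , α * entry₂₁ M′ + pow R q m * s * entry₂₁ M
       , α * entry₂₂ M′ + pow R q m * s * entry₂₂ M )
  Amat-two-step m (a , b , c′ , d) = first-row a c′ , first-row b d , second-row a c′ , second-row b d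
    where
    p = pow R q m
    first-row : ∀ u v →
      x * (x * u + (p * (x * x + s)) * v) + ((q * p) * (x * x + s)) * (1# * u + (p * x) * v)
      ≈ (1# + q * p) * x * (x * u + (p * (x * x + s)) * v) + (q * p) * s * u
    first-row = solve 6 (λ x s q p u v →
      x :* (x :* u :+ (p :* (x :* x :+ s)) :* v) :+ ((q :* p) :* (x :* x :+ s)) :* (con 1 :* u :+ (p :* x) :* v)
      := (con 1 :+ q :* p) :* x :* (x :* u :+ (p :* (x :* x :+ s)) :* v) :+ (q :* p) :* s :* u) refl x s q p
    second-row : ∀ u v →
      1# * (x * u + (p * (x * x + s)) * v) + ((q * p) * x) * (1# * u + (p * x) * v)
      ≈ (1# + q * p) * x * (1# * u + (p * x) * v) + p * s * v
    second-row = solve 6 (λ x s q p u v →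
      con 1 :* (x :* u :+ (p :* (x :* x :+ s)) :* v) :+ ((q :* p) :* x) :* (con 1 :* u :+ (p :* x) :* v)
      := (con 1 :+ q :* p) :* x :* (con 1 :* u :+ (p :* x) :* v) :+ p :* s :* v) refl x s q p

  -- All sequences below are shifted by one: index n refers to T_{n+1}, U_n and P_{n+1}.
  α : ℕ → Carrier
  α n = (1# + pow R q (suc (suc n))) * x

  β-first-row β-second-row : ℕ → Carrier
  β-first-row n = pow R q (suc (suc n)) * s
  β-second-row n = pow R q (suc n) * s

  P₁₁-recurrence : Recurrence α β-first-row (λ n → entry₁₁ (P (suc n)))
  P₁₁-recurrence n = proj₁ (Amat-two-step (suc n) (P (suc n)))

  P₁₂-recurrence : Recurrence α β-first-row (λ n → entry₁₂ (P (suc n)))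
  P₁₂-recurrence n = proj₁ (proj₂ (Amat-two-step (suc n) (P (suc n))))

  P₂₁-recurrence : Recurrence α β-second-row (λ n → entry₂₁ (P (suc n)))
  P₂₁-recurrence n = proj₁ (proj₂ (proj₂ (Amat-two-step (suc n) (P (suc n)))))

  P₂₂-recurrence : Recurrence α β-second-row (λ n → entry₂₂ (P (suc n)))
  P₂₂-recurrence n = proj₂ (proj₂ (proj₂ (Amat-two-step (suc n) (P (suc n)))))

  Tcheb-recurrence : ∀ s′ → Recurrence α (λ n → pow R q (suc (suc n)) * s′) (λ n → Tcheb R x s′ q (suc n))
  Tcheb-recurrence s′ n = refl

  Ucheb-recurrence : ∀ s′ → Recurrence α (λ n → pow R q (suc n) * s′) (Ucheb R x s′ q)
  Ucheb-recurrence s′ n = refl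

  module _ (q⁻¹ : Carrier) (q*q⁻¹≈1 : q * q⁻¹ ≈ 1#) where

    chebyshevMatrix : ℕ → Mat2 R
    chebyshevMatrix n =
      ( Tcheb R x s q (suc n)
      , (x * x + s) * Ucheb R x (q * s) q n
      , Ucheb R x s q n
      , Tcheb R x (s * q⁻¹) q (suc n) )

    q*p*[s*q⁻¹]≈p*s : ∀ p → (q * p) * (s * q⁻¹) ≈ p * s
    q*p*[s*q⁻¹]≈p*s p = trans (solve 4 (λ q p s q⁻¹ → (q :* p) :* (s :* q⁻¹) := (q :* q⁻¹) :* (p :* s)) refl q p s q⁻¹)
                              (trans (*-congʳ q*q⁻¹≈1) (*-identityˡ (p * s)))

    chebyshevMatrix-zero : chebyshevMatrix 0 ≋ P 1
    chebyshevMatrix-zero =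
        solve 2 (λ x s → x := x :* con 1 :+ (con 1 :* (x :* x :+ s)) :* con 0) refl x s
      , solve 2 (λ x s → (x :* x :+ s) :* con 1 := x :* con 0 :+ (con 1 :* (x :* x :+ s)) :* con 1) refl x s
      , solve 1 (λ x → con 1 := con 1 :* con 1 :+ (con 1 :* x) :* con 0) refl x
      , solve 1 (λ x → x := con 1 :* con 0 :+ (con 1 :* x) :* con 1) refl x

    chebyshevMatrix-one : chebyshevMatrix 1 ≋ P 2
    chebyshevMatrix-one =
        solve 3 (λ x s q →
          (con 1 :+ q :* con 1) :* x :* x :+ (q :* con 1) :* s :* con 1
          := x :* (x :* con 1 :+ (con 1 :* (x :* x :+ s)) :* con 0)
             :+ ((q :* con 1) :* (x :* x :+ s)) :* (con 1 :* con 1 :+ (con 1 :* x) :* con 0)) refl x s q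
      , solve 3 (λ x s q →
          (x :* x :+ s) :* ((con 1 :+ q) :* x)
          := x :* (x :* con 0 :+ (con 1 :* (x :* x :+ s)) :* con 1)
             :+ ((q :* con 1) :* (x :* x :+ s)) :* (con 1 :* con 0 :+ (con 1 :* x) :* con 1)) refl x s q
      , solve 3 (λ x s q →
          (con 1 :+ q) :* x
          := con 1 :* (x :* con 1 :+ (con 1 :* (x :* x :+ s)) :* con 0)
             :+ ((q :* con 1) :* x) :* (con 1 :* con 1 :+ (con 1 :* x) :* con 0)) refl x s q
      , trans (+-congˡ (trans (*-congʳ (q*p*[s*q⁻¹]≈p*s 1#)) (*-identityʳ _)))
          (solve 3 (λ x s q →
            (con 1 :+ q :* con 1) :* x :* x :+ con 1 :* s
            := con 1 :* (x :* con 0 :+ (con 1 :* (x :* x :+ s)) :* con 1)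
               :+ ((q :* con 1) :* x) :* (con 1 :* con 0 :+ (con 1 :* x) :* con 1)) refl x s q)

    chebyshevMatrix≈Aprod : ∀ n → chebyshevMatrix n ≋ P (suc n)
    chebyshevMatrix≈Aprod n =
      let (a₀ , b₀ , c₀ , d₀) = chebyshevMatrix-zero
          (a₁ , b₁ , c₁ , d₁) = chebyshevMatrix-one
      in recurrence-unique (Tcheb-recurrence s) P₁₁-recurrence a₀ a₁ n
       , recurrence-unique [x²+s]U[qs]-recurrence P₁₂-recurrence b₀ b₁ n
       , recurrence-unique (Ucheb-recurrence s) P₂₁-recurrence c₀ c₁ n
       , recurrence-unique T[s/q]-recurrence P₂₂-recurrence d₀ d₁ n
      where
      [x²+s]U[qs]-recurrence : Recurrence α β-first-row (λ n → (x * x + s) * Ucheb R x (q * s) q n)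
      [x²+s]U[qs]-recurrence =
        Recurrence-scaleˡ (x * x + s)
          (Recurrence-congʳ (λ n → p*[q*s]≈q*p*s (pow R q (suc n))) (Ucheb-recurrence (q * s)))
        where
        p*[q*s]≈q*p*s : ∀ p → p * (q * s) ≈ (q * p) * s
        p*[q*s]≈q*p*s p = trans (sym (*-assoc p q s)) (*-congʳ (*-comm p q))

      T[s/q]-recurrence : Recurrence α β-second-row (λ n → Tcheb R x (s * q⁻¹) q (suc n))
      T[s/q]-recurrence = Recurrence-congʳ (λ n → q*p*[s*q⁻¹]≈p*s (pow R q (suc n))) (Tcheb-recurrence (s * q⁻¹))

-- The paper's q ≠ 0 enters only through the inverse q⁻¹.
theorem2p9 : {c ℓ : Level} (R : CommutativeRing c ℓ) →
    let open CommutativeRing R in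
    (x s q q⁻¹ : Carrier) → q * q⁻¹ ≈ 1# → ¬ (q + 1# ≈ 0#) →
    (n : ℕ) →
    _≈ₘ_ R
      ( Tcheb R x s q (suc n)
      , (x * x + s) * Ucheb R x (q * s) q n
      , Ucheb R x s q n
      , Tcheb R x (s * q⁻¹) q (suc n) )
      (Aprod R x s q (suc n))
theorem2p9 R x s q q⁻¹ q*q⁻¹≈1 _ = ChebyshevProducts.chebyshevMatrix≈Aprod R x s q q⁻¹ q*q⁻¹≈1
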